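{- Let $\pi\in\mathfrak{S}_{n-1}(2413,4213)$ with $\mathrm{AVA}(\pi)=\{n=k_1>k_2>\cdots>k_m=1\}$. Then for every $1\le j\le m$, $$\mathrm{AVA}(T_{k_j}(\pi))=\{n+1,\ k_j+1,\ k_j,\ k_{j+1},\ \dots,\ k_m\},$$ where $n+1\ge k_j+1>k_j>k_{j+1}>\cdots>k_m=1$ (the elements $n+1$ and $k_j+1$ coincide when $j=1$).
   Context: $\mathfrak{S}_N(2413,4213)$ is the set of permutations of $[N]$ with no subsequence order-isomorphic to $2413$ or $4213$. For $\sigma=\sigma_1\cdots\sigma_{N}\in\mathfrak{S}_N$ and $k\in[N+1]$, the inserting operator is $T_k(\sigma)=\sigma'_1\sigma'_2\cdots\sigma'_{N}\,k\in\mathfrak{S}_{N+1}$, where $\sigma'_i=\sigma_i+1$ if $\sigma_i\ge k$ and $\sigma'_i=\sigma_i$ otherwise. For $\sigma\in\mathfrak{S}_N(2413,4213)$, the set of available inserting values is $\mathrm{AVA}(\sigma)=\{k\in[N+1]:T_k(\sigma)\in\mathfrak{S}_{N+1}(2413,4213)\}$. -}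

module Defs where

open import Data.Nat using (ℕ; zero; suc; _<_; _≤_; _≤ᵇ_)
open import Data.Bool using (if_then_else_)
open import Data.List using (List; []; _∷_; _++_; map; upTo)
open import Data.Product using (Σ; ∃; _×_)
open import Relation.Nullary using (¬_)
open import Data.List.Relation.Binary.Sublist.Propositional using (_⊆_)
open import Data.List.Relation.Binary.Permutation.Propositional using (_↭_)

range1 : ℕ → List ℕ
range1 N = map suc (upTo N)

IsPerm : ℕ → List ℕ → Set
IsPerm N σ = σ ↭ range1 N

Contains2413 : List ℕ → Set
Contains2413 σ = ∃ λ a → ∃ λ b → ∃ λ c → ∃ λ d →
  ((a ∷ b ∷ c ∷ d ∷ []) ⊆ σ) × (c < a × a < d × d < b)

Contains4213 : List ℕ → Set
Contains4213 σ = ∃ λ a → ∃ λ b → ∃ λ c → ∃ λ d →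
  ((a ∷ b ∷ c ∷ d ∷ []) ⊆ σ) × (c < b × b < d × d < a)

Avoids : List ℕ → Set
Avoids σ = ¬ Contains2413 σ × ¬ Contains4213 σ

InS : ℕ → List ℕ → Set
InS N σ = IsPerm N σ × Avoids σ

T : ℕ → List ℕ → List ℕ
T k σ = map (λ x → if k ≤ᵇ x then suc x else x) σ ++ (k ∷ [])

InAVA : ℕ → List ℕ → ℕ → Set
InAVA N σ k = (1 ≤ k × k ≤ suc N) × InS (suc N) (T k σ)

-- Appending k to a pattern-avoiding σ creates a 2413 or 4213 exactly when σ has a subsequence
-- x y z in which x and y lie on opposite sides of k (the smaller one below k, the larger one at
-- least k) and z lies below the smaller one; so AVA(σ) consists of the k ∈ [N+1] admitting no such
-- obstruction. Take σ = T_kj(π). Since the relabelling is order preserving, σ is obstructed at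
-- k ≤ kj exactly when π is, and σ obstructed at kj+1 would make π obstructed at kj. The largest
-- value n+1 is never obstructed, while every k with kj+1 < k ≤ n is obstructed by the values kj and
-- k-1 of π (in whichever order they occur) followed by the final entry kj.
module Submission where

open import Defs
open import Data.Nat using (ℕ; zero; suc; _>_; _≤_; _<_; _∸_; _≤ᵇ_; z≤n; s≤s; s<s)
open import Data.Nat.Properties
open import Data.Bool using (true; false; if_then_else_)
open import Data.Empty using (⊥-elim)
open import Data.List using (List; []; _∷_; _++_; [_]; last; map; upTo)
open import Data.List.Properties using (map-++; map-id-local; upTo-∷ʳ; ++-assoc)
open import Data.List.Membership.Propositional using (_∈_)
open import Data.List.Membership.Propositional.Properties using (∈-map⁺; ∈-map⁻; ∈-++⁺ʳ; ∈-++⁻; ∈-upTo⁺; ∈-upTo⁻)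
open import Data.List.Relation.Unary.All as All using (All; []; _∷_)
import Data.List.Relation.Unary.All.Properties as All
open import Data.List.Relation.Unary.Any using (here; there)
open import Data.List.Relation.Unary.Linked as Linked using (Linked; [-]; _∷_)
open import Data.List.Relation.Unary.Linked.Properties using (Linked⇒All)
open import Data.List.Relation.Binary.Pointwise using (Pointwise; []; _∷_)
open import Data.List.Relation.Binary.Sublist.Propositional using (_⊆_; []; _∷ʳ_; _∷_; minimum; to∈; from∈; ⊆-refl; ⊆-trans)
import Data.List.Relation.Binary.Sublist.Propositional.Properties as Sublist
open import Data.List.Relation.Binary.Permutation.Propositional using (_↭_; ↭-refl; ↭-reflexive; ↭-sym; ↭-swap; ↭-trans; module PermutationReasoning)
import Data.List.Relation.Binary.Permutation.Propositional.Properties as Perm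
open import Data.Maybe using (just)
open import Data.Product as Prod using (_×_; _,_; ∃; proj₁; proj₂)
open import Data.Sum as Sum using (_⊎_; inj₁; inj₂)
open import Function using (_∘_)
open import Function.Bundles using (_⇔_; mk⇔; Equivalence)
open import Relation.Binary.Core using (_Preserves_⟶_)
open import Relation.Binary.Definitions using (tri<; tri≈; tri>)
open import Relation.Binary.PropositionalEquality using (_≡_; _≢_; refl; sym; trans; cong; subst; module ≡-Reasoning)
open import Relation.Nullary using (¬_; yes; no; contradiction)
open import Relation.Nullary.Reflects using (ofʸ; ofⁿ)

open Equivalence using (to; from)

-- The relabelling of the inserting operator: T k σ is definitionally map (shift k) σ ++ [ k ].
shift : ℕ → ℕ → ℕ
shift k x = if k ≤ᵇ x then suc x else x

shift-< : ∀ {k x} → x < k → shift k x ≡ x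
shift-< {k} {x} x<k with k ≤ᵇ x | ≤ᵇ-reflects-≤ k x
... | true  | ofʸ k≤x = contradiction k≤x (<⇒≱ x<k)
... | false | _       = refl

shift-≥ : ∀ {k x} → k ≤ x → shift k x ≡ suc x
shift-≥ {k} {x} k≤x with k ≤ᵇ x | ≤ᵇ-reflects-≤ k x
... | true  | _       = refl
... | false | ofⁿ k≰x = contradiction k≤x k≰x

x≤shift : ∀ k x → x ≤ shift k x
x≤shift k x with <-≤-connex x k
... | inj₁ x<k rewrite shift-< x<k = ≤-refl
... | inj₂ k≤x rewrite shift-≥ k≤x = n≤1+n x

k<shift : ∀ {k x} → k ≤ x → k < shift k x
k<shift k≤x rewrite shift-≥ k≤x = s≤s k≤x

shift-mono-< : ∀ k → shift k Preserves _<_ ⟶ _<_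
shift-mono-< k {x} {y} x<y with <-≤-connex x k
... | inj₁ x<k rewrite shift-< x<k = <-≤-trans x<y (x≤shift k y)
... | inj₂ k≤x rewrite shift-≥ k≤x | shift-≥ (≤-trans k≤x (<⇒≤ x<y)) = s≤s x<y

shift-cancel-< : ∀ k {x y} → shift k x < shift k y → x < y
shift-cancel-< k {x} {y} p with <-cmp x y
... | tri< x<y _ _ = x<y
... | tri≈ _ refl _ = contradiction p (<-irrefl refl)
... | tri> _ _ y<x = contradiction (shift-mono-< k y<x) (<-asym p)

shift-<-below : ∀ {k kj} → k ≤ kj → ∀ v → shift kj v < k ⇔ v < k
shift-<-below {k} {kj} k≤kj v = mk⇔
  (≤-<-trans (x≤shift kj v))
  (λ v<k → subst (_< k) (sym (shift-< (<-≤-trans v<k k≤kj))) v<k)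

shift-<-suc : ∀ kj v → shift kj v < suc kj ⇔ v < kj
shift-<-suc kj v = mk⇔
  (λ p → ≰⇒> (λ kj≤v → <⇒≱ p (subst (suc kj ≤_) (sym (shift-≥ kj≤v)) (s≤s kj≤v))))
  (λ v<kj → subst (_< suc kj) (sym (shift-< v<kj)) (m<n⇒m<1+n v<kj))

<⇔<⇒≥⇔≥ : ∀ {a k b k′} → (a < k ⇔ b < k′) → (k ≤ a ⇔ k′ ≤ b)
<⇔<⇒≥⇔≥ a<k⇔b<k′ = mk⇔
  (λ k≤a → ≮⇒≥ (λ b<k′ → <⇒≱ (from a<k⇔b<k′ b<k′) k≤a))
  (λ k′≤b → ≮⇒≥ (λ a<k → <⇒≱ (to a<k⇔b<k′ a<k) k′≤b))

range1-suc : ∀ N → range1 (suc N) ≡ range1 N ++ [ suc N ]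
range1-suc N = trans (cong (map suc) (sym (upTo-∷ʳ N))) (map-++ suc (upTo N) (N ∷ []))

∈-range1⁻ : ∀ {N v} → v ∈ range1 N → 1 ≤ v × v ≤ N
∈-range1⁻ v∈ with ∈-map⁻ suc v∈
... | u , u∈ , refl = s≤s z≤n , ∈-upTo⁻ u∈

∈-range1⁺ : ∀ {N v} → 1 ≤ v → v ≤ N → v ∈ range1 N
∈-range1⁺ (s≤s z≤n) v≤N = ∈-map⁺ suc (∈-upTo⁺ v≤N)

∈-IsPerm⇔ : ∀ {N τ v} → IsPerm N τ → v ∈ τ ⇔ (1 ≤ v × v ≤ N)
∈-IsPerm⇔ τ↭ = mk⇔
  (∈-range1⁻ ∘ Perm.∈-resp-↭ τ↭)
  (λ (1≤v , v≤N) → Perm.∈-resp-↭ (↭-sym τ↭) (∈-range1⁺ 1≤v v≤N))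

map-shift-range1 : ∀ {k} N → N < k → map (shift k) (range1 N) ≡ range1 N
map-shift-range1 N N<k =
  map-id-local (All.tabulate (λ v∈ → shift-< (≤-<-trans (proj₂ (∈-range1⁻ v∈)) N<k)))

map-shift-range1-suc : ∀ {k} N → k ≤ suc N →
  map (shift k) (range1 (suc N)) ≡ map (shift k) (range1 N) ++ [ suc (suc N) ]
map-shift-range1-suc {k} N k≤1+N = begin
  map (shift k) (range1 (suc N))                   ≡⟨ cong (map (shift k)) (range1-suc N) ⟩
  map (shift k) (range1 N ++ [ suc N ])            ≡⟨ map-++ (shift k) (range1 N) [ suc N ] ⟩
  map (shift k) (range1 N) ++ [ shift k (suc N) ]  ≡⟨ cong (λ x → map (shift k) (range1 N) ++ [ x ]) (shift-≥ k≤1+N) ⟩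
  map (shift k) (range1 N) ++ [ suc (suc N) ]      ∎
  where open ≡-Reasoning

T-range1↭ : ∀ N {k} → 1 ≤ k → k ≤ suc N → T k (range1 N) ↭ range1 (suc N)
T-range1↭ N {k} 1≤k k≤1+N with m≤n⇒m<n∨m≡n k≤1+N
... | inj₂ refl = ↭-reflexive (begin
  T k (range1 N)         ≡⟨ cong (_++ [ k ]) (map-shift-range1 N ≤-refl) ⟩
  range1 N ++ [ suc N ]  ≡⟨ range1-suc N ⟨
  range1 (suc N)         ∎)
  where open ≡-Reasoning
T-range1↭ (suc N) {k} 1≤k _ | inj₁ (s≤s k≤1+N) = begin
  T k (range1 (suc N))                       ≡⟨ cong (_++ [ k ]) (map-shift-range1-suc N k≤1+N) ⟩
  (A ++ [ suc (suc N) ]) ++ [ k ]            ≡⟨ ++-assoc A [ suc (suc N) ] [ k ] ⟩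
  A ++ [ suc (suc N) ] ++ [ k ]              ↭⟨ Perm.++⁺ˡ A (↭-swap (suc (suc N)) k ↭-refl) ⟩
  A ++ [ k ] ++ [ suc (suc N) ]              ≡⟨ ++-assoc A [ k ] [ suc (suc N) ] ⟨
  (A ++ [ k ]) ++ [ suc (suc N) ]            ↭⟨ Perm.++⁺ʳ [ suc (suc N) ] (T-range1↭ N 1≤k k≤1+N) ⟩
  range1 (suc N) ++ [ suc (suc N) ]          ≡⟨ range1-suc (suc N) ⟨
  range1 (suc (suc N))                       ∎
  where
  open PermutationReasoning
  A : List ℕ
  A = map (shift k) (range1 N)
T-range1↭ zero (s≤s z≤n) _ | inj₁ (s≤s ())

T-IsPerm : ∀ {N τ k} → IsPerm N τ → 1 ≤ k → k ≤ suc N → IsPerm (suc N) (T k τ)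
T-IsPerm {N} {k = k} τ↭ 1≤k k≤1+N =
  ↭-trans (Perm.++⁺ʳ (k ∷ []) (Perm.map⁺ (shift k) τ↭)) (T-range1↭ N 1≤k k≤1+N)

⊆-map⁻ : ∀ {A B : Set} (f : B → A) {xs} ys → xs ⊆ map f ys →
  ∃ λ zs → zs ⊆ ys × Pointwise (λ x z → x ≡ f z) xs zs
⊆-map⁻ f [] [] = [] , [] , []
⊆-map⁻ f (y ∷ ys) (_ ∷ʳ xs⊆) with ⊆-map⁻ f ys xs⊆
... | zs , zs⊆ , xs≡ = zs , y ∷ʳ zs⊆ , xs≡
⊆-map⁻ f (y ∷ ys) (x≡fy ∷ xs⊆) with ⊆-map⁻ f ys xs⊆
... | zs , zs⊆ , xs≡ = y ∷ zs , refl ∷ zs⊆ , x≡fy ∷ xs≡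

++[]⊈[] : ∀ {A : Set} (xs : List A) {x} → ¬ (xs ++ [ x ] ⊆ [])
++[]⊈[] []      ()
++[]⊈[] (_ ∷ _) ()

⊆-++[]⁻ : ∀ {A : Set} (xs ys : List A) {x y} → xs ++ [ x ] ⊆ ys ++ [ y ] →
  (xs ++ [ x ] ⊆ ys) ⊎ (xs ⊆ ys × x ≡ y)
⊆-++[]⁻ []       []       (x≡y ∷ _)  = inj₂ ([] , x≡y)
⊆-++[]⁻ []       (z ∷ ys) (x≡z ∷ _)  = inj₁ (x≡z ∷ minimum ys)
⊆-++[]⁻ (w ∷ xs) (z ∷ ys) (w≡z ∷ p)  = Sum.map (w≡z ∷_) (Prod.map₁ (w≡z ∷_)) (⊆-++[]⁻ xs ys p)
⊆-++[]⁻ (_ ∷ xs) []       (_ ∷ p)    = ⊥-elim (++[]⊈[] xs p)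
⊆-++[]⁻ xs       (z ∷ ys) (.z ∷ʳ p)  = Sum.map (z ∷ʳ_) (Prod.map₁ (z ∷ʳ_)) (⊆-++[]⁻ xs ys p)
⊆-++[]⁻ xs       []       (_ ∷ʳ p)   = ⊥-elim (++[]⊈[] xs p)

pair-⊆-some-order : ∀ {A : Set} {x y : A} {xs} → x ∈ xs → y ∈ xs → x ≢ y →
  (x ∷ y ∷ [] ⊆ xs) ⊎ (y ∷ x ∷ [] ⊆ xs)
pair-⊆-some-order (here refl) (here refl) x≢y = contradiction refl x≢y
pair-⊆-some-order (here refl) (there y∈)  _   = inj₁ (refl ∷ from∈ y∈)
pair-⊆-some-order (there x∈)  (here refl) _   = inj₂ (refl ∷ from∈ x∈)
pair-⊆-some-order (there x∈)  (there y∈)  x≢y = Sum.map (_ ∷ʳ_) (_ ∷ʳ_) (pair-⊆-some-order x∈ y∈ x≢y)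

Straddles : ℕ → ℕ → ℕ → ℕ → Set
Straddles k lo hi bot = bot < lo × lo < k × k ≤ hi

-- Completed by a final entry k, a triple with Straddles k x y z would be a 2413, one with
-- Straddles k y x z a 4213.
Obstructed : List ℕ → ℕ → Set
Obstructed τ k = ∃ λ x → ∃ λ y → ∃ λ z → (x ∷ y ∷ z ∷ [] ⊆ τ) ×
  (Straddles k x y z ⊎ Straddles k y x z)

Straddles-map⁺ : ∀ (g : ℕ → ℕ) {k k′ lo hi bot} → g Preserves _<_ ⟶ _<_ → (∀ v → g v < k ⇔ v < k′) →
  Straddles k′ lo hi bot → Straddles k (g lo) (g hi) (g bot)
Straddles-map⁺ g {lo = lo} {hi} mono threshold (bot<lo , lo<k′ , k′≤hi) =
  mono bot<lo , from (threshold lo) lo<k′ , from (<⇔<⇒≥⇔≥ (threshold hi)) k′≤hi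

Straddles-map⁻ : ∀ (g : ℕ → ℕ) {k k′ lo hi bot} → (∀ {a b} → g a < g b → a < b) → (∀ v → g v < k ⇔ v < k′) →
  Straddles k (g lo) (g hi) (g bot) → Straddles k′ lo hi bot
Straddles-map⁻ g {lo = lo} {hi} cancel threshold (bot<lo , lo<k , k≤hi) =
  cancel bot<lo , to (threshold lo) lo<k , to (<⇔<⇒≥⇔≥ (threshold hi)) k≤hi

¬Straddles-tight : ∀ {k lo hi bot} → k ≤ suc bot → ¬ Straddles k lo hi bot
¬Straddles-tight k≤1+bot (bot<lo , lo<k , _) = <⇒≱ bot<lo (≤-pred (≤-trans lo<k k≤1+bot))

Obstructed-⊆ : ∀ {τ τ′ k} → τ ⊆ τ′ → Obstructed τ k → Obstructed τ′ k
Obstructed-⊆ τ⊆τ′ (x , y , z , xyz⊆ , straddle) = x , y , z , ⊆-trans xyz⊆ τ⊆τ′ , straddle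

¬Obstructed-bounded : ∀ {τ k} → (∀ {v} → v ∈ τ → v < k) → ¬ Obstructed τ k
¬Obstructed-bounded bounded (_ , _ , _ , xyz⊆ , inj₁ (_ , _ , k≤y)) = <⇒≱ (bounded (to∈ (Sublist.∷ˡ⁻ xyz⊆))) k≤y
¬Obstructed-bounded bounded (_ , _ , _ , xyz⊆ , inj₂ (_ , _ , k≤x)) = <⇒≱ (bounded (to∈ xyz⊆)) k≤x

Obstructed-map⁺ : ∀ {g τ k k′} → g Preserves _<_ ⟶ _<_ → (∀ v → g v < k ⇔ v < k′) →
  Obstructed τ k′ → Obstructed (map g τ) k
Obstructed-map⁺ {g} mono threshold (x , y , z , xyz⊆ , straddle) =
  g x , g y , g z , Sublist.map⁺ g xyz⊆ ,
  Sum.map (Straddles-map⁺ g mono threshold) (Straddles-map⁺ g mono threshold) straddle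

Obstructed-map⁻ : ∀ {g τ k k′} → (∀ {a b} → g a < g b → a < b) → (∀ v → g v < k ⇔ v < k′) →
  Obstructed (map g τ) k → Obstructed τ k′
Obstructed-map⁻ {g} {τ} cancel threshold (_ , _ , _ , xyz⊆ , straddle) with ⊆-map⁻ g τ xyz⊆
... | x ∷ y ∷ z ∷ [] , xyz⊆′ , refl ∷ refl ∷ refl ∷ [] =
  x , y , z , xyz⊆′ ,
  Sum.map (Straddles-map⁻ g cancel threshold) (Straddles-map⁻ g cancel threshold) straddle

Contains2413-map⁻ : ∀ {g τ} → (∀ {a b} → g a < g b → a < b) → Contains2413 (map g τ) → Contains2413 τ
Contains2413-map⁻ {g} {τ} cancel (_ , _ , _ , _ , abcd⊆ , c<a , a<d , d<b) with ⊆-map⁻ g τ abcd⊆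
... | a ∷ b ∷ c ∷ d ∷ [] , abcd⊆′ , refl ∷ refl ∷ refl ∷ refl ∷ [] =
  a , b , c , d , abcd⊆′ , cancel c<a , cancel a<d , cancel d<b

Contains4213-map⁻ : ∀ {g τ} → (∀ {a b} → g a < g b → a < b) → Contains4213 (map g τ) → Contains4213 τ
Contains4213-map⁻ {g} {τ} cancel (_ , _ , _ , _ , abcd⊆ , c<b , b<d , d<a) with ⊆-map⁻ g τ abcd⊆
... | a ∷ b ∷ c ∷ d ∷ [] , abcd⊆′ , refl ∷ refl ∷ refl ∷ refl ∷ [] =
  a , b , c , d , abcd⊆′ , cancel c<b , cancel b<d , cancel d<a

Contains2413-++[]⁻ : ∀ {τ k} → Contains2413 (τ ++ [ k ]) → Contains2413 τ ⊎ Obstructed τ k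
Contains2413-++[]⁻ {τ} (a , b , c , d , abcd⊆ , c<a , a<d , d<b) with ⊆-++[]⁻ (a ∷ b ∷ c ∷ []) τ abcd⊆
... | inj₁ abcd⊆′        = inj₁ (a , b , c , d , abcd⊆′ , c<a , a<d , d<b)
... | inj₂ (abc⊆ , refl) = inj₂ (a , b , c , abc⊆ , inj₁ (c<a , a<d , <⇒≤ d<b))

Contains4213-++[]⁻ : ∀ {τ k} → Contains4213 (τ ++ [ k ]) → Contains4213 τ ⊎ Obstructed τ k
Contains4213-++[]⁻ {τ} (a , b , c , d , abcd⊆ , c<b , b<d , d<a) with ⊆-++[]⁻ (a ∷ b ∷ c ∷ []) τ abcd⊆
... | inj₁ abcd⊆′        = inj₁ (a , b , c , d , abcd⊆′ , c<b , b<d , d<a)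
... | inj₂ (abc⊆ , refl) = inj₂ (a , b , c , abc⊆ , inj₂ (c<b , b<d , <⇒≤ d<a))

avoids-T : ∀ {τ k} → Avoids τ → ¬ Obstructed τ k → Avoids (T k τ)
avoids-T {τ} {k} (∌2413 , ∌4213) unobstructed =
  Sum.[ ∌2413 ∘ Contains2413-map⁻ (shift-cancel-< k) , unobstructed ∘ unshift ] ∘ Contains2413-++[]⁻ ,
  Sum.[ ∌4213 ∘ Contains4213-map⁻ (shift-cancel-< k) , unobstructed ∘ unshift ] ∘ Contains4213-++[]⁻
  where
  unshift : Obstructed (map (shift k) τ) k → Obstructed τ k
  unshift = Obstructed-map⁻ (shift-cancel-< k) (shift-<-below ≤-refl)

avoids-T⇒¬Obstructed : ∀ {τ k} → Avoids (T k τ) → ¬ Obstructed τ k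
avoids-T⇒¬Obstructed {k = k} (∌2413 , _) (x , y , z , xyz⊆ , inj₁ (z<x , x<k , k≤y)) =
  ∌2413 (shift k x , shift k y , shift k z , k , Sublist.++⁺ (Sublist.map⁺ (shift k) xyz⊆) ⊆-refl ,
         shift-mono-< k z<x , from (shift-<-below ≤-refl x) x<k , k<shift k≤y)
avoids-T⇒¬Obstructed {k = k} (_ , ∌4213) (x , y , z , xyz⊆ , inj₂ (z<y , y<k , k≤x)) =
  ∌4213 (shift k x , shift k y , shift k z , k , Sublist.++⁺ (Sublist.map⁺ (shift k) xyz⊆) ⊆-refl ,
         shift-mono-< k z<y , from (shift-<-below ≤-refl y) y<k , k<shift k≤x)

InAVA⇔ : ∀ {N τ k} → InS N τ → InAVA N τ k ⇔ ((1 ≤ k × k ≤ suc N) × ¬ Obstructed τ k)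
InAVA⇔ (τ↭ , avoids) = mk⇔
  (λ (bounds , _ , T-avoids) → bounds , avoids-T⇒¬Obstructed T-avoids)
  (λ ((1≤k , k≤1+N) , unobstructed) → (1≤k , k≤1+N) , T-IsPerm τ↭ 1≤k k≤1+N , avoids-T avoids unobstructed)

Obstructed-T⇒shifted : ∀ {kj τ k} → k ≤ suc kj → Obstructed (T kj τ) k → Obstructed (map (shift kj) τ) k
Obstructed-T⇒shifted {kj} {τ} k≤1+kj (x , y , z , xyz⊆ , straddle) with ⊆-++[]⁻ (x ∷ y ∷ []) (map (shift kj) τ) xyz⊆
... | inj₁ xyz⊆′     = x , y , z , xyz⊆′ , straddle
... | inj₂ (_ , refl) = ⊥-elim (Sum.[ ¬Straddles-tight k≤1+kj , ¬Straddles-tight k≤1+kj ] straddle)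

Obstructed-T-below⁻ : ∀ {kj τ k} → k ≤ kj → Obstructed (T kj τ) k → Obstructed τ k
Obstructed-T-below⁻ {kj} k≤kj =
  Obstructed-map⁻ (shift-cancel-< kj) (shift-<-below k≤kj) ∘ Obstructed-T⇒shifted (m≤n⇒m≤1+n k≤kj)

Obstructed-T-below⁺ : ∀ {kj τ k} → k ≤ kj → Obstructed τ k → Obstructed (T kj τ) k
Obstructed-T-below⁺ {kj} k≤kj =
  Obstructed-⊆ (Sublist.++⁺ʳ [ kj ] ⊆-refl) ∘ Obstructed-map⁺ (shift-mono-< kj) (shift-<-below k≤kj)

Obstructed-T-suc⁻ : ∀ {kj τ} → Obstructed (T kj τ) (suc kj) → Obstructed τ kj
Obstructed-T-suc⁻ {kj} = Obstructed-map⁻ (shift-cancel-< kj) (shift-<-suc kj) ∘ Obstructed-T⇒shifted ≤-refl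

Obstructed-T-between : ∀ {kj τ k} → kj ∈ τ → k ∈ τ → kj < k → Obstructed (T kj τ) (suc k)
Obstructed-T-between {kj} {τ} {k} kj∈τ k∈τ kj<k =
  Sum.[ (λ ⊆τ → _ , _ , _ , extend ⊆τ , inj₁ straddle) , (λ ⊆τ → _ , _ , _ , extend ⊆τ , inj₂ straddle) ]
    (pair-⊆-some-order kj∈τ k∈τ (<⇒≢ kj<k))
  where
  extend : ∀ {p q} → p ∷ q ∷ [] ⊆ τ → shift kj p ∷ shift kj q ∷ kj ∷ [] ⊆ T kj τ
  extend ⊆τ = Sublist.++⁺ (Sublist.map⁺ (shift kj) ⊆τ) ⊆-refl
  straddle : Straddles (suc k) (shift kj kj) (shift kj k) kj
  straddle rewrite shift-≥ (≤-refl {kj}) | shift-≥ (<⇒≤ kj<k) = n<1+n kj , s<s kj<k , ≤-refl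

module _ {m π kj} (π∈S : InS m π) (kj∈AVA : InAVA m π kj) where

  private
    1≤kj : 1 ≤ kj
    1≤kj = proj₁ (proj₁ kj∈AVA)

    kj≤1+m : kj ≤ suc m
    kj≤1+m = proj₂ (proj₁ kj∈AVA)

    σ∈S : InS (suc m) (T kj π)
    σ∈S = proj₂ kj∈AVA

    ¬Obstructed-kj : ¬ Obstructed π kj
    ¬Obstructed-kj = proj₂ (to (InAVA⇔ π∈S) kj∈AVA)

    Obstructed-T-inner : ∀ {k} → suc kj < k → k < suc (suc m) → Obstructed (T kj π) k
    Obstructed-T-inner {suc k} (s≤s kj<k) (s≤s k<1+m) =
      Obstructed-T-between (in-π 1≤kj (≤-trans (<⇒≤ kj<k) k≤m)) (in-π (≤-trans 1≤kj (<⇒≤ kj<k)) k≤m) kj<k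
      where
      k≤m : k ≤ m
      k≤m = ≤-pred k<1+m
      in-π : ∀ {v} → 1 ≤ v → v ≤ m → v ∈ π
      in-π 1≤v v≤m = from (∈-IsPerm⇔ (proj₁ π∈S)) (1≤v , v≤m)

  T-available : ∀ {L k} → (∀ {k} → k ∈ L → k < kj × InAVA m π k) →
    k ∈ suc (suc m) ∷ suc kj ∷ kj ∷ L → InAVA (suc m) (T kj π) k
  T-available _ (here refl) =
    from (InAVA⇔ σ∈S) ((s≤s z≤n , ≤-refl) , ¬Obstructed-bounded (s≤s ∘ proj₂ ∘ to (∈-IsPerm⇔ (proj₁ σ∈S))))
  T-available _ (there (here refl)) =
    from (InAVA⇔ σ∈S) ((s≤s z≤n , s≤s kj≤1+m) , ¬Obstructed-kj ∘ Obstructed-T-suc⁻)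
  T-available _ (there (there (here refl))) =
    from (InAVA⇔ σ∈S) ((1≤kj , m≤n⇒m≤1+n kj≤1+m) , ¬Obstructed-kj ∘ Obstructed-T-below⁻ ≤-refl)
  T-available below (there (there (there k∈L))) with below k∈L
  ... | k<kj , k∈AVA with to (InAVA⇔ π∈S) k∈AVA
  ...   | (1≤k , k≤1+m) , unobstructed =
    from (InAVA⇔ σ∈S) ((1≤k , m≤n⇒m≤1+n k≤1+m) , unobstructed ∘ Obstructed-T-below⁻ (<⇒≤ k<kj))

  T-available⁻ : ∀ {L k} → (∀ {k} → k < kj × InAVA m π k → k ∈ L) →
    InAVA (suc m) (T kj π) k → k ∈ suc (suc m) ∷ suc kj ∷ kj ∷ L
  T-available⁻ {k = k} below k∈AVA with to (InAVA⇔ σ∈S) k∈AVA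
  ... | (1≤k , k≤2+m) , unobstructed with <-cmp k kj
  ...   | tri< k<kj _ _ = there (there (there (below (k<kj , from (InAVA⇔ π∈S)
          ((1≤k , ≤-trans (<⇒≤ k<kj) kj≤1+m) , unobstructed ∘ Obstructed-T-below⁺ (<⇒≤ k<kj))))))
  ...   | tri≈ _ k≡kj _ = there (there (here k≡kj))
  ...   | tri> _ _ kj<k with k ≟ suc (suc m) | k ≟ suc kj
  ...     | yes k≡2+m | _          = here k≡2+m
  ...     | no _      | yes k≡1+kj = there (here k≡1+kj)
  ...     | no k≢2+m  | no k≢1+kj  =
    contradiction (Obstructed-T-inner (≤∧≢⇒< kj<k (k≢1+kj ∘ sym)) (≤∧≢⇒< k≤2+m k≢2+m)) unobstructed

  AVA-T⇔ : ∀ {L} → (∀ k → k ∈ L ⇔ (k < kj × InAVA m π k)) →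
    ∀ k → InAVA (suc m) (T kj π) k ⇔ (k ∈ suc (suc m) ∷ suc kj ∷ kj ∷ L)
  AVA-T⇔ L⇔ k = mk⇔ (T-available⁻ (from (L⇔ _))) (T-available (to (L⇔ _)))

Linked>⇒All< : ∀ {x xs} → Linked _>_ (x ∷ xs) → All (_< x) xs
Linked>⇒All< [-]            = []
Linked>⇒All< (x>y ∷ linked) = Linked⇒All (λ i>j j>k → <-trans j>k i>j) x>y linked

Linked>-split : ∀ pre {x post} → Linked _>_ (pre ++ x ∷ post) → All (x <_) pre × All (_< x) post
Linked>-split []        linked = [] , Linked>⇒All< linked
Linked>-split (p ∷ pre) linked with Linked>-split pre (Linked.tail linked)
... | above , below = All.head (All.++⁻ʳ pre (Linked>⇒All< linked)) ∷ above , below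

∈-Linked>-suffix⇔ : ∀ pre {x post k} → Linked _>_ (pre ++ x ∷ post) →
  k ∈ post ⇔ (k < x × k ∈ pre ++ x ∷ post)
∈-Linked>-suffix⇔ pre {x} {post} {k} linked = mk⇔
  (λ k∈post → All.lookup below k∈post , ∈-++⁺ʳ pre (there k∈post))
  (λ (k<x , k∈) → suffix k<x (∈-++⁻ pre k∈))
  where
  above : All (x <_) pre
  above = proj₁ (Linked>-split pre linked)
  below : All (_< x) post
  below = proj₂ (Linked>-split pre linked)
  suffix : k < x → k ∈ pre ⊎ k ∈ x ∷ post → k ∈ post
  suffix k<x (inj₁ k∈pre)         = contradiction (All.lookup above k∈pre) (<-asym k<x)
  suffix k<x (inj₂ (here k≡x))    = contradiction k<x (<-irrefl k≡x)
  suffix _   (inj₂ (there k∈post)) = k∈post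

lemma5p3 : (n : ℕ) → 1 ≤ n → (π : List ℕ) → InS (n ∸ 1) π →
    (rest : List ℕ) → Linked _>_ (n ∷ rest) → last (n ∷ rest) ≡ just 1 →
    (∀ k → InAVA (n ∸ 1) π k ⇔ (k ∈ n ∷ rest)) →
    (pre post : List ℕ) (kj : ℕ) → n ∷ rest ≡ pre ++ (kj ∷ post) →
    ∀ k → InAVA n (T kj π) k ⇔ (k ∈ suc n ∷ suc kj ∷ kj ∷ post)
lemma5p3 (suc m) _ π π∈S rest linked _ AVA⇔ pre post kj split = AVA-T⇔ π∈S kj∈AVA post⇔
  where
  linked′ : Linked _>_ (pre ++ kj ∷ post)
  linked′ = subst (Linked _>_) split linked
  AVA⇔′ : ∀ k → InAVA m π k ⇔ (k ∈ pre ++ kj ∷ post)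
  AVA⇔′ k = subst (λ ks → InAVA m π k ⇔ (k ∈ ks)) split (AVA⇔ k)
  kj∈AVA : InAVA m π kj
  kj∈AVA = from (AVA⇔′ kj) (∈-++⁺ʳ pre (here refl))
  post⇔ : ∀ k → k ∈ post ⇔ (k < kj × InAVA m π k)
  post⇔ k = mk⇔
    (Prod.map₂ (from (AVA⇔′ k)) ∘ to (∈-Linked>-suffix⇔ pre linked′))
    (from (∈-Linked>-suffix⇔ pre linked′) ∘ Prod.map₂ (to (AVA⇔′ k)))
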